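{- Let $M_3$ denote the set of $3\times 3$ matrices with entries in $\mathbb Z$, and let $\nu:\mathbb Z^3\to M_3$ be a map. Then $\nu$ is a natural injection if and only if there exist integers $\alpha,\beta,\phi,\delta,\gamma,\rho,\sigma,\theta,\lambda$ such that for all $(x,y,z)\in\mathbb Z^3$ $$\nu(x,y,z)=\begin{pmatrix} \alpha (x - z) + \beta y + z & \beta (x - z) + \phi y & (1 - \alpha )(x - z) - \beta y \\ \delta (x - z) + \gamma y & \gamma (x - z) + \rho y + z & - \delta (x - z) + (1 - \gamma )y \\ \sigma (x - z) + \theta y & \theta (x - z) + \lambda y & - \sigma (x - z) - \theta y + z \end{pmatrix}$$ and the parameters satisfy one of the following three sets of conditions: (A) $\phi=\lambda$, $\gamma\neq 0$, $\beta=\frac{\theta(\gamma-1)}{\gamma}$, $\phi=\lambda=\frac{\theta(\rho\gamma+\theta)}{\gamma^2}$, and $\alpha=\frac{\gamma^3+\sigma\gamma^2-\sigma\gamma-\delta(\rho\gamma+\theta)}{\gamma^2}$; (B) $\phi=\lambda$, $\gamma=0$, $\theta=0$, $\phi=\lambda=-\beta(\rho-\beta)$, and $\sigma=-\delta(\rho-\beta)$ (with $\alpha,\beta,\delta,\rho$ arbitrary); (C) $\phi\neq\lambda$, $\alpha=\frac{\phi\gamma-\lambda-\beta(\rho+\theta-\beta)}{\phi-\lambda}$, $\delta=\frac{\beta\gamma-\theta\gamma+\theta}{\phi-\lambda}$, and $\sigma=\frac{\lambda\gamma-\theta(\rho+\theta-\beta)}{\phi-\lambda}$.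
   Context: A map $\nu:\mathbb Z^3\to M_3$ (where $M_3$ is the set of $3\times3$ integer matrices) is called a natural injection if it is injective and satisfies: (1) $\nu(\nu(\mathbf a).\mathbf b)=\nu(\mathbf a).\nu(\mathbf b)$ for all $\mathbf a,\mathbf b\in\mathbb Z^3$; (2) $\nu(\mathbf a).\mathbf b=\nu(\mathbf b).\mathbf a$ for all $\mathbf a,\mathbf b\in\mathbb Z^3$; (3) $\nu(1,0,1)=I_3$. Here "." denotes the usual matrix product, and elements of $\mathbb Z^3$ are treated as column vectors when multiplied by matrices. For natural $\nu$, the product $\mathbf a\bullet\mathbf b=\nu(\mathbf a).\mathbf b$ makes $(\mathbb Z^3,\bullet)$ a commutative monoid with identity $(1,0,1)$. -}

module Defs where

open import Data.Integer using (ℤ; +_; _+_; _*_; _-_; -_; 1ℤ; 0ℤ)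
open import Data.Vec using (Vec; []; _∷_; map; zipWith; foldr; transpose)
open import Data.Product using (_×_; Σ; ∃; _,_)
open import Data.Sum using (_⊎_)
open import Relation.Binary.PropositionalEquality using (_≡_; _≢_)
open import Function.Definitions using (Injective)

-- ℤ³ : column vectors of integers; M₃ : 3×3 integer matrices (list of rows)
Z3 : Set
Z3 = Vec ℤ 3

M3 : Set
M3 = Vec (Vec ℤ 3) 3

vec3 : ℤ → ℤ → ℤ → Z3
vec3 x y z = x ∷ y ∷ z ∷ []

mat3 : ℤ → ℤ → ℤ → ℤ → ℤ → ℤ → ℤ → ℤ → ℤ → M3
mat3 a b c d e f g h i = (a ∷ b ∷ c ∷ []) ∷ (d ∷ e ∷ f ∷ []) ∷ (g ∷ h ∷ i ∷ []) ∷ []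

dot : ∀ {n} → Vec ℤ n → Vec ℤ n → ℤ
dot u v = foldr _ _+_ 0ℤ (zipWith _*_ u v)

_·v_ : M3 → Z3 → Z3
A ·v v = map (λ row → dot row v) A

_·m_ : M3 → M3 → M3
A ·m B = map (λ row → map (λ col → dot row col) (transpose B)) A

I3 : M3
I3 = mat3 1ℤ 0ℤ 0ℤ 0ℤ 1ℤ 0ℤ 0ℤ 0ℤ 1ℤ

NaturalInjection : (Z3 → M3) → Set
NaturalInjection ν =
  Injective _≡_ _≡_ ν
  × (∀ a b → ν (ν a ·v b) ≡ ν a ·m ν b)
  × (∀ a b → ν a ·v b ≡ ν b ·v a)
  × (ν (vec3 1ℤ 0ℤ 1ℤ) ≡ I3)

-- the explicit matrix form with parameters α β φ δ γ ρ σ θ λ (λ written lm)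
formMat : (α β φ δ γ ρ σ θ lm : ℤ) → ℤ → ℤ → ℤ → M3
formMat α β φ δ γ ρ σ θ lm x y z =
  mat3 (α * (x - z) + β * y + z)      (β * (x - z) + φ * y)          ((1ℤ - α) * (x - z) - β * y)
       (δ * (x - z) + γ * y)          (γ * (x - z) + ρ * y + z)      (- δ * (x - z) + (1ℤ - γ) * y)
       (σ * (x - z) + θ * y)          (θ * (x - z) + lm * y)         (- σ * (x - z) - θ * y + z)

-- Conditions (A), (B), (C); divisions in the paper are stated with denominators cleared
CondA : (α β φ δ γ ρ σ θ lm : ℤ) → Set
CondA α β φ δ γ ρ σ θ lm =
  φ ≡ lm
  × γ ≢ 0ℤ
  × β * γ ≡ θ * (γ - 1ℤ)
  × φ * (γ * γ) ≡ θ * (ρ * γ + θ)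
  × lm * (γ * γ) ≡ θ * (ρ * γ + θ)
  × α * (γ * γ) ≡ γ * γ * γ + σ * (γ * γ) - σ * γ - δ * (ρ * γ + θ)

CondB : (α β φ δ γ ρ σ θ lm : ℤ) → Set
CondB α β φ δ γ ρ σ θ lm =
  φ ≡ lm
  × γ ≡ 0ℤ
  × θ ≡ 0ℤ
  × φ ≡ - (β * (ρ - β))
  × lm ≡ - (β * (ρ - β))
  × σ ≡ - (δ * (ρ - β))

CondC : (α β φ δ γ ρ σ θ lm : ℤ) → Set
CondC α β φ δ γ ρ σ θ lm =
  φ ≢ lm
  × α * (φ - lm) ≡ φ * γ - lm - β * (ρ + θ - β)
  × δ * (φ - lm) ≡ β * γ - θ * γ + θ
  × σ * (φ - lm) ≡ lm * γ - θ * (ρ + θ - β)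

HasExplicitForm : (Z3 → M3) → Set
HasExplicitForm ν =
  Σ ℤ λ α → Σ ℤ λ β → Σ ℤ λ φ → Σ ℤ λ δ → Σ ℤ λ γ →
  Σ ℤ λ ρ → Σ ℤ λ σ → Σ ℤ λ θ → Σ ℤ λ lm →
    (∀ x y z → ν (vec3 x y z) ≡ formMat α β φ δ γ ρ σ θ lm x y z)
    × (CondA α β φ δ γ ρ σ θ lm ⊎ CondB α β φ δ γ ρ σ θ lm ⊎ CondC α β φ δ γ ρ σ θ lm)

-- Write a • b = ν(a) b. Conditions (2) and (3) make • commutative with unit 𝟙 = (1,0,1), and
-- then the columns of ν(a) are ν(a) eⱼ = ν(eⱼ) a. Hence ν is determined by the coordinates of
-- e₁•e₁, e₁•e₂ and e₂•e₂, which are the nine parameters of the explicit form (the form uses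
-- the basis 𝟙, e₁, e₂, in which (x,y,z) has coordinates (z, x - z, y)); injectivity is free,
-- since a = ν(a) 𝟙. Condition (1) evaluated at c says (a•b)•c = a•(b•c). By trilinearity the
-- associator of a, b, c is (a₁c₂ - a₂c₁)(b₁ A + b₂ B), where aᵢ, bᵢ, cᵢ are coordinates in
-- the basis 𝟙, e₁, e₂ and A, B are the associators of (e₁,e₁,e₂) and (e₁,e₂,e₂). So (1)
-- amounts to five polynomial equations in the parameters, which are solved by dividing by
-- φ - λ when φ ≠ λ (case C), by γ when φ = λ and γ ≠ 0 (case A), and directly when
-- φ = λ and γ = 0 (case B).
{-# OPTIONS --safe #-}
module Submission where

open import Defs
open import Data.Integer using (ℤ; _+_; _*_; _-_; -_; 0ℤ; 1ℤ; ≢-nonZero)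
open import Data.Integer.Properties
  using (_≟_; *-comm; *-zeroʳ; +-identityʳ; *-cancelʳ-≡; neg-injective; i≡j⇒i-j≡0; i-j≡0⇒i≡j)
open import Data.Integer.Tactic.RingSolver using (solve-∀)
open import Data.Fin using (Fin; zero; suc)
open import Data.Vec using (Vec; []; _∷_; lookup; map; zipWith; transpose)
open import Data.Product using (_×_; _,_; proj₁; proj₂)
open import Data.Sum using (_⊎_; inj₁; inj₂)
open import Function using (_∘_)
open import Function.Definitions using (Injective)
open import Relation.Binary.PropositionalEquality
  using (_≡_; _≢_; refl; sym; trans; cong; cong₂; subst₂)
open import Relation.Nullary using (yes; no)

-- Vectors and 3 × 3 matrices

e₁ e₂ e₃ 𝟙 : Z3
e₁ = 1ℤ ∷ 0ℤ ∷ 0ℤ ∷ []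
e₂ = 0ℤ ∷ 1ℤ ∷ 0ℤ ∷ []
e₃ = 0ℤ ∷ 0ℤ ∷ 1ℤ ∷ []
𝟙  = 1ℤ ∷ 0ℤ ∷ 1ℤ ∷ []

infixl 6 _-ᵥ_
_-ᵥ_ : Z3 → Z3 → Z3
_-ᵥ_ = zipWith _-_

column : Fin 3 → M3 → Z3
column j = map (λ row → lookup row j)

entry : Fin 3 → Fin 3 → M3 → ℤ
entry i j M = lookup (lookup M i) j

vec3-cong : ∀ {A : Set} {x y z x′ y′ z′ : A} →
  x ≡ x′ → y ≡ y′ → z ≡ z′ → x ∷ y ∷ z ∷ [] ≡ x′ ∷ y′ ∷ z′ ∷ []
vec3-cong refl refl refl = refl

vec3-ext : ∀ {A : Set} {u v : Vec A 3} →
  lookup u zero ≡ lookup v zero → lookup u (suc zero) ≡ lookup v (suc zero) →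
  lookup u (suc (suc zero)) ≡ lookup v (suc (suc zero)) → u ≡ v
vec3-ext {u = _ ∷ _ ∷ _ ∷ []} {_ ∷ _ ∷ _ ∷ []} refl refl refl = refl

vec3-elim : ∀ {P : Z3 → Set} → (∀ x y z → P (x ∷ y ∷ z ∷ [])) → ∀ a → P a
vec3-elim p (x ∷ y ∷ z ∷ []) = p x y z

vec3-elim₂ : ∀ {P : Z3 → Z3 → Set} →
  (∀ x y z u v w → P (x ∷ y ∷ z ∷ []) (u ∷ v ∷ w ∷ [])) → ∀ a b → P a b
vec3-elim₂ p (x ∷ y ∷ z ∷ []) (u ∷ v ∷ w ∷ []) = p x y z u v w

vec3-elim₃ : ∀ {P : Z3 → Z3 → Z3 → Set} →
  (∀ x y z u v w r s t → P (x ∷ y ∷ z ∷ []) (u ∷ v ∷ w ∷ []) (r ∷ s ∷ t ∷ [])) → ∀ a b c → P a b c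
vec3-elim₃ p (x ∷ y ∷ z ∷ []) (u ∷ v ∷ w ∷ []) (r ∷ s ∷ t ∷ []) = p x y z u v w r s t

dot-comm : ∀ {n} (u v : Vec ℤ n) → dot u v ≡ dot v u
dot-comm []      []      = refl
dot-comm (x ∷ u) (y ∷ v) = cong₂ _+_ (*-comm x y) (dot-comm u v)

dot-e₁ : ∀ x y z → x * 1ℤ + (y * 0ℤ + (z * 0ℤ + 0ℤ)) ≡ x
dot-e₁ = solve-∀

dot-e₂ : ∀ x y z → x * 0ℤ + (y * 1ℤ + (z * 0ℤ + 0ℤ)) ≡ y
dot-e₂ = solve-∀

dot-e₃ : ∀ x y z → x * 0ℤ + (y * 0ℤ + (z * 1ℤ + 0ℤ)) ≡ z
dot-e₃ = solve-∀

·v-e₁ : ∀ M → M ·v e₁ ≡ column zero M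
·v-e₁ ((a ∷ b ∷ c ∷ []) ∷ (d ∷ e ∷ f ∷ []) ∷ (g ∷ h ∷ i ∷ []) ∷ []) =
  vec3-cong (dot-e₁ a b c) (dot-e₁ d e f) (dot-e₁ g h i)

·v-e₂ : ∀ M → M ·v e₂ ≡ column (suc zero) M
·v-e₂ ((a ∷ b ∷ c ∷ []) ∷ (d ∷ e ∷ f ∷ []) ∷ (g ∷ h ∷ i ∷ []) ∷ []) =
  vec3-cong (dot-e₂ a b c) (dot-e₂ d e f) (dot-e₂ g h i)

·v-e₃ : ∀ M → M ·v e₃ ≡ column (suc (suc zero)) M
·v-e₃ ((a ∷ b ∷ c ∷ []) ∷ (d ∷ e ∷ f ∷ []) ∷ (g ∷ h ∷ i ∷ []) ∷ []) =
  vec3-cong (dot-e₃ a b c) (dot-e₃ d e f) (dot-e₃ g h i)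

I3-·v : ∀ a → I3 ·v a ≡ a
I3-·v (x ∷ y ∷ z ∷ []) = vec3-cong
  (trans (dot-comm e₁ (x ∷ y ∷ z ∷ [])) (dot-e₁ x y z))
  (trans (dot-comm e₂ (x ∷ y ∷ z ∷ [])) (dot-e₂ x y z))
  (trans (dot-comm e₃ (x ∷ y ∷ z ∷ [])) (dot-e₃ x y z))

columns-injective : ∀ {A B : M3} →
  column zero A ≡ column zero B → column (suc zero) A ≡ column (suc zero) B →
  column (suc (suc zero)) A ≡ column (suc (suc zero)) B → A ≡ B
columns-injective {(_ ∷ _ ∷ _ ∷ []) ∷ (_ ∷ _ ∷ _ ∷ []) ∷ (_ ∷ _ ∷ _ ∷ []) ∷ []}
                  {(_ ∷ _ ∷ _ ∷ []) ∷ (_ ∷ _ ∷ _ ∷ []) ∷ (_ ∷ _ ∷ _ ∷ []) ∷ []} refl refl refl = refl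

M3-ext : ∀ {A B : M3} → (∀ c → A ·v c ≡ B ·v c) → A ≡ B
M3-ext {A} {B} A·≡B· = columns-injective
  (trans (sym (·v-e₁ A)) (trans (A·≡B· e₁) (·v-e₁ B)))
  (trans (sym (·v-e₂ A)) (trans (A·≡B· e₂) (·v-e₂ B)))
  (trans (sym (·v-e₃ A)) (trans (A·≡B· e₃) (·v-e₃ B)))

dot-·m : ∀ a₀ a₁ a₂ b₀₀ b₀₁ b₀₂ b₁₀ b₁₁ b₁₂ b₂₀ b₂₁ b₂₂ c₀ c₁ c₂ →
  let d u₀ u₁ u₂ v₀ v₁ v₂ = u₀ * v₀ + (u₁ * v₁ + (u₂ * v₂ + 0ℤ)) in
  d (d a₀ a₁ a₂ b₀₀ b₁₀ b₂₀) (d a₀ a₁ a₂ b₀₁ b₁₁ b₂₁) (d a₀ a₁ a₂ b₀₂ b₁₂ b₂₂) c₀ c₁ c₂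
    ≡ d a₀ a₁ a₂ (d b₀₀ b₀₁ b₀₂ c₀ c₁ c₂) (d b₁₀ b₁₁ b₁₂ c₀ c₁ c₂) (d b₂₀ b₂₁ b₂₂ c₀ c₁ c₂)
dot-·m = solve-∀

dot-·m-row : ∀ (a : Z3) B c → dot (map (λ col → dot a col) (transpose B)) c ≡ dot a (B ·v c)
dot-·m-row (a₀ ∷ a₁ ∷ a₂ ∷ [])
           ((b₀₀ ∷ b₀₁ ∷ b₀₂ ∷ []) ∷ (b₁₀ ∷ b₁₁ ∷ b₁₂ ∷ []) ∷ (b₂₀ ∷ b₂₁ ∷ b₂₂ ∷ []) ∷ [])
           (c₀ ∷ c₁ ∷ c₂ ∷ []) = dot-·m a₀ a₁ a₂ b₀₀ b₀₁ b₀₂ b₁₀ b₁₁ b₁₂ b₂₀ b₂₁ b₂₂ c₀ c₁ c₂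

·m-·v : ∀ A B c → (A ·m B) ·v c ≡ A ·v (B ·v c)
·m-·v (a₀ ∷ a₁ ∷ a₂ ∷ []) B c = vec3-cong (dot-·m-row a₀ B c) (dot-·m-row a₁ B c) (dot-·m-row a₂ B c)

·v-𝟙⇒third-column : ∀ M {a} → M ·v 𝟙 ≡ a → column (suc (suc zero)) M ≡ a -ᵥ column zero M
·v-𝟙⇒third-column ((m₀ ∷ m₁ ∷ m₂ ∷ []) ∷ (m₃ ∷ m₄ ∷ m₅ ∷ []) ∷ (m₆ ∷ m₇ ∷ m₈ ∷ []) ∷ []) refl =
  vec3-cong (third m₀ m₁ m₂) (third m₃ m₄ m₅) (third m₆ m₇ m₈)
  where
  third : ∀ a b c → c ≡ (a * 1ℤ + (b * 0ℤ + (c * 1ℤ + 0ℤ))) - a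
  third = solve-∀

-- Conditions on ν

Commutative Unital Multiplicative Associative : (Z3 → M3) → Set
Commutative ν    = ∀ a b → ν a ·v b ≡ ν b ·v a
Unital ν         = ν 𝟙 ≡ I3
Multiplicative ν = ∀ a b → ν (ν a ·v b) ≡ ν a ·m ν b
Associative ν    = ∀ a b c → ν (ν a ·v b) ·v c ≡ ν a ·v (ν b ·v c)

multiplicative⇒associative : ∀ {ν} → Multiplicative ν → Associative ν
multiplicative⇒associative {ν} mult a b c = trans (cong (_·v c) (mult a b)) (·m-·v (ν a) (ν b) c)

associative⇒multiplicative : ∀ {ν} → Associative ν → Multiplicative ν
associative⇒multiplicative {ν} assoc a b =
  M3-ext λ c → trans (assoc a b c) (sym (·m-·v (ν a) (ν b) c))

module _ {ν : Z3 → M3} (comm : Commutative ν) (unit : Unital ν) where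

  ν-·v-𝟙 : ∀ a → ν a ·v 𝟙 ≡ a
  ν-·v-𝟙 a = trans (comm a 𝟙) (trans (cong (_·v a) unit) (I3-·v a))

  commutative-unital⇒injective : Injective _≡_ _≡_ ν
  commutative-unital⇒injective {a} {b} νa≡νb =
    trans (sym (ν-·v-𝟙 a)) (trans (cong (_·v 𝟙) νa≡νb) (ν-·v-𝟙 b))

natural-resp : ∀ {ν ν′} → (∀ a → ν a ≡ ν′ a) → NaturalInjection ν → NaturalInjection ν′
natural-resp {ν} {ν′} ν≗ν′ (inj , mult , comm , unit) = inj′ , mult′ , comm′ , trans (sym (ν≗ν′ 𝟙)) unit
  where
  inj′ : Injective _≡_ _≡_ ν′
  inj′ {a} {b} ν′a≡ν′b = inj (trans (ν≗ν′ a) (trans ν′a≡ν′b (sym (ν≗ν′ b))))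
  comm′ : Commutative ν′
  comm′ a b = subst₂ (λ M N → M ·v b ≡ N ·v a) (ν≗ν′ a) (ν≗ν′ b) (comm a b)
  mult′ : Multiplicative ν′
  mult′ a b = subst₂ (λ M N → ν′ (M ·v b) ≡ M ·m N) (ν≗ν′ a) (ν≗ν′ b)
                     (trans (sym (ν≗ν′ (ν a ·v b))) (mult a b))

-- The parameters are the coordinates of e₁•e₁ = (α, δ, σ), e₁•e₂ = (β, γ, θ) and
-- e₂•e₂ = (φ, ρ, λ), read off from the columns of N₁ = ν e₁ and N₂ = ν e₂.
module BasisParameters (N₁ N₂ : M3) where
  α β φ δ γ ρ σ θ lm : ℤ
  α  = entry zero zero N₁
  δ  = entry (suc zero) zero N₁
  σ  = entry (suc (suc zero)) zero N₁
  β  = entry zero (suc zero) N₁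
  γ  = entry (suc zero) (suc zero) N₁
  θ  = entry (suc (suc zero)) (suc zero) N₁
  φ  = entry zero (suc zero) N₂
  ρ  = entry (suc zero) (suc zero) N₂
  lm = entry (suc (suc zero)) (suc zero) N₂

explicit-form-from-columns : ∀ (M N₁ N₂ : M3) x y z → let a = vec3 x y z in
  column zero N₂ ≡ column (suc zero) N₁ →
  column (suc (suc zero)) N₁ ≡ e₁ -ᵥ column zero N₁ →
  column (suc (suc zero)) N₂ ≡ e₂ -ᵥ column zero N₂ →
  column zero M ≡ N₁ ·v a →
  column (suc zero) M ≡ N₂ ·v a →
  column (suc (suc zero)) M ≡ a -ᵥ column zero M →
  let open BasisParameters N₁ N₂ in M ≡ formMat α β φ δ γ ρ σ θ lm x y z
explicit-form-from-columns
  ((_ ∷ _ ∷ _ ∷ []) ∷ (_ ∷ _ ∷ _ ∷ []) ∷ (_ ∷ _ ∷ _ ∷ []) ∷ [])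
  ((n₀₀ ∷ n₀₁ ∷ _ ∷ []) ∷ (n₁₀ ∷ n₁₁ ∷ _ ∷ []) ∷ (n₂₀ ∷ n₂₁ ∷ _ ∷ []) ∷ [])
  ((_ ∷ p₀₁ ∷ _ ∷ []) ∷ (_ ∷ p₁₁ ∷ _ ∷ []) ∷ (_ ∷ p₂₁ ∷ _ ∷ []) ∷ [])
  x y z refl refl refl refl refl refl = vec3-cong
    (vec3-cong (unit-entry n₀₀ n₀₁ x y z) (zero-entry n₀₁ p₀₁ x y z) (third-entry₀ n₀₀ n₀₁ x y z))
    (vec3-cong (zero-entry n₁₀ n₁₁ x y z) (unit-entry n₁₁ p₁₁ x y z) (third-entry₁ n₁₀ n₁₁ x y z))
    (vec3-cong (zero-entry n₂₀ n₂₁ x y z) (zero-entry n₂₁ p₂₁ x y z) (third-entry₂ n₂₀ n₂₁ x y z))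
  where
  unit-entry : ∀ a b x y z → a * x + (b * y + ((1ℤ - a) * z + 0ℤ)) ≡ a * (x - z) + b * y + z
  unit-entry = solve-∀
  zero-entry : ∀ a b x y z → a * x + (b * y + ((0ℤ - a) * z + 0ℤ)) ≡ a * (x - z) + b * y
  zero-entry = solve-∀
  third-entry₀ : ∀ a b x y z →
    x - (a * x + (b * y + ((1ℤ - a) * z + 0ℤ))) ≡ (1ℤ - a) * (x - z) - b * y
  third-entry₀ = solve-∀
  third-entry₁ : ∀ a b x y z →
    y - (a * x + (b * y + ((0ℤ - a) * z + 0ℤ))) ≡ - a * (x - z) + (1ℤ - b) * y
  third-entry₁ = solve-∀
  third-entry₂ : ∀ a b x y z →
    z - (a * x + (b * y + ((0ℤ - a) * z + 0ℤ))) ≡ - a * (x - z) - b * y + z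
  third-entry₂ = solve-∀

module CommutativeUnital {ν : Z3 → M3} (comm : Commutative ν) (unit : Unital ν) where
  open BasisParameters (ν e₁) (ν e₂) public

  third-column : ∀ a → column (suc (suc zero)) (ν a) ≡ a -ᵥ column zero (ν a)
  third-column a = ·v-𝟙⇒third-column (ν a) (ν-·v-𝟙 comm unit a)

  explicit-form : ∀ x y z → ν (vec3 x y z) ≡ formMat α β φ δ γ ρ σ θ lm x y z
  explicit-form x y z = explicit-form-from-columns (ν a) (ν e₁) (ν e₂) x y z
    (trans (sym (·v-e₁ (ν e₂))) (trans (comm e₂ e₁) (·v-e₂ (ν e₁))))
    (third-column e₁)
    (third-column e₂)
    (trans (sym (·v-e₁ (ν a))) (comm a e₁))
    (trans (sym (·v-e₂ (ν a))) (comm a e₂))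
    (third-column a)
    where
    a : Z3
    a = vec3 x y z

-- The associativity equations

-- In the basis 𝟙, e₁, e₂ the associators are
--   (e₁•e₁)•e₂ - e₁•(e₁•e₂) = D₃ 𝟙 + D₁ e₁ + D₂ e₂   and   (e₁•e₂)•e₂ - e₁•(e₂•e₂) = F₃ 𝟙 + F₁ e₁ - D₁ e₂.
module AssociatorCoordinates (α β φ δ γ ρ σ θ lm : ℤ) where
  D₁ D₂ D₃ F₁ F₃ : ℤ
  D₁ = δ * (φ - lm) - (β - θ) * γ - θ
  D₂ = (α - σ) * γ + δ * ρ + σ - (β - θ) * δ - γ * γ
  D₃ = (α - σ) * θ + δ * lm - (β - θ) * σ - γ * θ
  F₁ = (β - θ) * (β - θ) + γ * (φ - lm) - (φ - lm) * (α - σ) - ρ * (β - θ) - lm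
  F₃ = (β - θ) * θ + γ * lm - (φ - lm) * σ - ρ * θ

record AssociativityEquations (α β φ δ γ ρ σ θ lm : ℤ) : Set where
  open AssociatorCoordinates α β φ δ γ ρ σ θ lm
  field
    D₁≡0 : D₁ ≡ 0ℤ
    D₂≡0 : D₂ ≡ 0ℤ
    D₃≡0 : D₃ ≡ 0ℤ
    F₁≡0 : F₁ ≡ 0ℤ
    F₃≡0 : F₃ ≡ 0ℤ

Conditions : (α β φ δ γ ρ σ θ lm : ℤ) → Set
Conditions α β φ δ γ ρ σ θ lm =
  CondA α β φ δ γ ρ σ θ lm ⊎ CondB α β φ δ γ ρ σ θ lm ⊎ CondC α β φ δ γ ρ σ θ lm

cancel : ∀ {x k} → k ≢ 0ℤ → x * k ≡ 0ℤ → x ≡ 0ℤ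
cancel {x} {k} k≢0 xk≡0 = *-cancelʳ-≡ x 0ℤ k {{≢-nonZero k≢0}} xk≡0

-- In the identities below a vanishing quantity stands to the left of its coefficient,
-- because 0ℤ * c reduces to 0ℤ while c * 0ℤ does not.

module CaseC where

  D₁≡δ-residual : ∀ α β φ δ γ ρ σ θ lm →
    δ * (φ - lm) - (β - θ) * γ - θ ≡ δ * (φ - lm) - (β * γ - θ * γ + θ)
  D₁≡δ-residual = solve-∀

  F₃≡σ-residual : ∀ α β φ δ γ ρ σ θ lm →
    (β - θ) * θ + γ * lm - (φ - lm) * σ - ρ * θ ≡ (lm * γ - θ * (ρ + θ - β)) - σ * (φ - lm)
  F₃≡σ-residual = solve-∀

  F₁+F₃≡α-residual : ∀ α β φ δ γ ρ σ θ lm →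
    let F₁ = (β - θ) * (β - θ) + γ * (φ - lm) - (φ - lm) * (α - σ) - ρ * (β - θ) - lm
        F₃ = (β - θ) * θ + γ * lm - (φ - lm) * σ - ρ * θ
    in F₁ + F₃ ≡ (φ * γ - lm - β * (ρ + θ - β)) - α * (φ - lm)
  F₁+F₃≡α-residual = solve-∀

  F₁≡residuals : ∀ α β φ δ γ ρ σ θ lm →
    (β - θ) * (β - θ) + γ * (φ - lm) - (φ - lm) * (α - σ) - ρ * (β - θ) - lm
      ≡ ((φ * γ - lm - β * (ρ + θ - β)) - α * (φ - lm)) - ((lm * γ - θ * (ρ + θ - β)) - σ * (φ - lm))
  F₁≡residuals = solve-∀

  D₂-syzygy : ∀ α β φ δ γ ρ σ θ lm →
    let D₁ = δ * (φ - lm) - (β - θ) * γ - θ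
        D₂ = (α - σ) * γ + δ * ρ + σ - (β - θ) * δ - γ * γ
        F₁ = (β - θ) * (β - θ) + γ * (φ - lm) - (φ - lm) * (α - σ) - ρ * (β - θ) - lm
        F₃ = (β - θ) * θ + γ * lm - (φ - lm) * σ - ρ * θ
    in D₂ * (φ - lm) ≡ D₁ * (θ + ρ - β) - F₁ * γ - F₃
  D₂-syzygy = solve-∀

  D₃-syzygy : ∀ α β φ δ γ ρ σ θ lm →
    let D₁ = δ * (φ - lm) - (β - θ) * γ - θ
        D₃ = (α - σ) * θ + δ * lm - (β - θ) * σ - γ * θ
        F₁ = (β - θ) * (β - θ) + γ * (φ - lm) - (φ - lm) * (α - σ) - ρ * (β - θ) - lm
        F₃ = (β - θ) * θ + γ * lm - (φ - lm) * σ - ρ * θ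
    in D₃ * (φ - lm) ≡ D₁ * lm - F₁ * θ + F₃ * (β - θ)
  D₃-syzygy = solve-∀

  equations⇒condition : ∀ {α β φ δ γ ρ σ θ lm} → φ ≢ lm →
    AssociativityEquations α β φ δ γ ρ σ θ lm → CondC α β φ δ γ ρ σ θ lm
  equations⇒condition {α} {β} {φ} {δ} {γ} {ρ} {σ} {θ} {lm} φ≢lm eqs =
      φ≢lm
    , sym (i-j≡0⇒i≡j _ _ (trans (sym (F₁+F₃≡α-residual α β φ δ γ ρ σ θ lm)) (cong₂ _+_ F₁≡0 F₃≡0)))
    , i-j≡0⇒i≡j _ _ (trans (sym (D₁≡δ-residual α β φ δ γ ρ σ θ lm)) D₁≡0)
    , sym (i-j≡0⇒i≡j _ _ (trans (sym (F₃≡σ-residual α β φ δ γ ρ σ θ lm)) F₃≡0))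
    where open AssociativityEquations eqs

  condition⇒equations : ∀ {α β φ δ γ ρ σ θ lm} →
    CondC α β φ δ γ ρ σ θ lm → AssociativityEquations α β φ δ γ ρ σ θ lm
  condition⇒equations {α} {β} {φ} {δ} {γ} {ρ} {σ} {θ} {lm} (φ≢lm , α-eq , δ-eq , σ-eq) =
    record { D₁≡0 = D₁≡0 ; D₂≡0 = D₂≡0 ; D₃≡0 = D₃≡0 ; F₁≡0 = F₁≡0 ; F₃≡0 = F₃≡0 }
    where
    open AssociatorCoordinates α β φ δ γ ρ σ θ lm
    φ-lm≢0 : φ - lm ≢ 0ℤ
    φ-lm≢0 = φ≢lm ∘ i-j≡0⇒i≡j φ lm
    D₁≡0 : D₁ ≡ 0ℤ
    D₁≡0 = trans (D₁≡δ-residual α β φ δ γ ρ σ θ lm) (i≡j⇒i-j≡0 δ-eq)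
    F₃≡0 : F₃ ≡ 0ℤ
    F₃≡0 = trans (F₃≡σ-residual α β φ δ γ ρ σ θ lm) (i≡j⇒i-j≡0 (sym σ-eq))
    F₁≡0 : F₁ ≡ 0ℤ
    F₁≡0 = trans (F₁≡residuals α β φ δ γ ρ σ θ lm)
                 (cong₂ _-_ (i≡j⇒i-j≡0 (sym α-eq)) (i≡j⇒i-j≡0 (sym σ-eq)))
    D₂≡0 : D₂ ≡ 0ℤ
    D₂≡0 = cancel φ-lm≢0 (trans (D₂-syzygy α β φ δ γ ρ σ θ lm)
      (cong₂ _-_ (cong₂ _-_ (cong (_* (θ + ρ - β)) D₁≡0) (cong (_* γ) F₁≡0)) F₃≡0))
    D₃≡0 : D₃ ≡ 0ℤ
    D₃≡0 = cancel φ-lm≢0 (trans (D₃-syzygy α β φ δ γ ρ σ θ lm)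
      (cong₂ _+_ (cong₂ _-_ (cong (_* lm) D₁≡0) (cong (_* θ) F₁≡0)) (cong (_* (β - θ)) F₃≡0)))

module CaseA where

  D₁≡β-residual : ∀ β δ γ θ lm → δ * (lm - lm) - (β - θ) * γ - θ ≡ θ * (γ - 1ℤ) - β * γ
  D₁≡β-residual = solve-∀

  λ-residual : ∀ β δ γ ρ σ θ lm →
    let D₁ = δ * (lm - lm) - (β - θ) * γ - θ
        F₃ = (β - θ) * θ + γ * lm - (lm - lm) * σ - ρ * θ
    in F₃ * γ + D₁ * θ ≡ lm * (γ * γ) - θ * (ρ * γ + θ)
  λ-residual = solve-∀

  α-residual : ∀ α β δ γ ρ σ θ lm →
    let D₁ = δ * (lm - lm) - (β - θ) * γ - θ
        D₂ = (α - σ) * γ + δ * ρ + σ - (β - θ) * δ - γ * γ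
    in D₂ * γ - D₁ * δ ≡ α * (γ * γ) - (γ * γ * γ + σ * (γ * γ) - σ * γ - δ * (ρ * γ + θ))
  α-residual = solve-∀

  F₃γ≡residuals : ∀ β δ γ ρ σ θ lm →
    ((β - θ) * θ + γ * lm - (lm - lm) * σ - ρ * θ) * γ
      ≡ (lm * (γ * γ) - θ * (ρ * γ + θ)) - (θ * (γ - 1ℤ) - β * γ) * θ
  F₃γ≡residuals = solve-∀

  D₂γ≡residuals : ∀ α β δ γ ρ σ θ →
    ((α - σ) * γ + δ * ρ + σ - (β - θ) * δ - γ * γ) * γ
      ≡ (α * (γ * γ) - (γ * γ * γ + σ * (γ * γ) - σ * γ - δ * (ρ * γ + θ))) + (θ * (γ - 1ℤ) - β * γ) * δ
  D₂γ≡residuals = solve-∀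

  F₁-syzygy : ∀ α β δ γ ρ σ θ lm →
    let D₁ = δ * (lm - lm) - (β - θ) * γ - θ
        F₁ = (β - θ) * (β - θ) + γ * (lm - lm) - (lm - lm) * (α - σ) - ρ * (β - θ) - lm
        F₃ = (β - θ) * θ + γ * lm - (lm - lm) * σ - ρ * θ
    in F₁ * γ ≡ D₁ * (θ + ρ - β) - F₃
  F₁-syzygy = solve-∀

  D₃-syzygy : ∀ α β φ δ γ ρ σ θ lm →
    let D₁ = δ * (φ - lm) - (β - θ) * γ - θ
        D₂ = (α - σ) * γ + δ * ρ + σ - (β - θ) * δ - γ * γ
        D₃ = (α - σ) * θ + δ * lm - (β - θ) * σ - γ * θ
        F₃ = (β - θ) * θ + γ * lm - (φ - lm) * σ - ρ * θ
    in D₃ * γ ≡ D₂ * θ + F₃ * δ + D₁ * σ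
  D₃-syzygy = solve-∀

  equations⇒condition : ∀ {α β δ γ ρ σ θ lm} → γ ≢ 0ℤ →
    AssociativityEquations α β lm δ γ ρ σ θ lm → CondA α β lm δ γ ρ σ θ lm
  equations⇒condition {α} {β} {δ} {γ} {ρ} {σ} {θ} {lm} γ≢0 eqs =
    refl , γ≢0 , β-eq , λ-eq , λ-eq , α-eq
    where
    open AssociativityEquations eqs
    β-eq : β * γ ≡ θ * (γ - 1ℤ)
    β-eq = sym (i-j≡0⇒i≡j _ _ (trans (sym (D₁≡β-residual β δ γ θ lm)) D₁≡0))
    λ-eq : lm * (γ * γ) ≡ θ * (ρ * γ + θ)
    λ-eq = i-j≡0⇒i≡j _ _ (trans (sym (λ-residual β δ γ ρ σ θ lm))
      (cong₂ _+_ (cong (_* γ) F₃≡0) (cong (_* θ) D₁≡0)))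
    α-eq : α * (γ * γ) ≡ γ * γ * γ + σ * (γ * γ) - σ * γ - δ * (ρ * γ + θ)
    α-eq = i-j≡0⇒i≡j _ _ (trans (sym (α-residual α β δ γ ρ σ θ lm))
      (cong₂ _-_ (cong (_* γ) D₂≡0) (cong (_* δ) D₁≡0)))

  condition⇒equations : ∀ {α β δ γ ρ σ θ lm} →
    CondA α β lm δ γ ρ σ θ lm → AssociativityEquations α β lm δ γ ρ σ θ lm
  condition⇒equations {α} {β} {δ} {γ} {ρ} {σ} {θ} {lm} (_ , γ≢0 , β-eq , _ , λ-eq , α-eq) =
    record { D₁≡0 = D₁≡0 ; D₂≡0 = D₂≡0 ; D₃≡0 = D₃≡0 ; F₁≡0 = F₁≡0 ; F₃≡0 = F₃≡0 }
    where
    open AssociatorCoordinates α β lm δ γ ρ σ θ lm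
    β-residual≡0 : θ * (γ - 1ℤ) - β * γ ≡ 0ℤ
    β-residual≡0 = i≡j⇒i-j≡0 (sym β-eq)
    D₁≡0 : D₁ ≡ 0ℤ
    D₁≡0 = trans (D₁≡β-residual β δ γ θ lm) β-residual≡0
    F₃≡0 : F₃ ≡ 0ℤ
    F₃≡0 = cancel γ≢0 (trans (F₃γ≡residuals β δ γ ρ σ θ lm)
      (cong₂ _-_ (i≡j⇒i-j≡0 λ-eq) (cong (_* θ) β-residual≡0)))
    D₂≡0 : D₂ ≡ 0ℤ
    D₂≡0 = cancel γ≢0 (trans (D₂γ≡residuals α β δ γ ρ σ θ)
      (cong₂ _+_ (i≡j⇒i-j≡0 α-eq) (cong (_* δ) β-residual≡0)))
    F₁≡0 : F₁ ≡ 0ℤ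
    F₁≡0 = cancel γ≢0 (trans (F₁-syzygy α β δ γ ρ σ θ lm)
      (cong₂ _-_ (cong (_* (θ + ρ - β)) D₁≡0) F₃≡0))
    D₃≡0 : D₃ ≡ 0ℤ
    D₃≡0 = cancel γ≢0 (trans (D₃-syzygy α β lm δ γ ρ σ θ lm)
      (cong₂ _+_ (cong₂ _+_ (cong (_* θ) D₂≡0) (cong (_* δ) F₃≡0)) (cong (_* σ) D₁≡0)))

module CaseB where

  D₁≡-θ : ∀ β δ θ lm → δ * (lm - lm) - (β - θ) * 0ℤ - θ ≡ - θ
  D₁≡-θ = solve-∀

  D₂≡σ-residual : ∀ α β δ ρ σ →
    (α - σ) * 0ℤ + δ * ρ + σ - (β - 0ℤ) * δ - 0ℤ * 0ℤ ≡ σ - - (δ * (ρ - β))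
  D₂≡σ-residual = solve-∀

  F₁≡λ-residual : ∀ α β ρ σ lm →
    (β - 0ℤ) * (β - 0ℤ) + 0ℤ * (lm - lm) - (lm - lm) * (α - σ) - ρ * (β - 0ℤ) - lm
      ≡ - (β * (ρ - β)) - lm
  F₁≡λ-residual = solve-∀

  F₃≡0 : ∀ β ρ σ lm → (β - 0ℤ) * 0ℤ + 0ℤ * lm - (lm - lm) * σ - ρ * 0ℤ ≡ 0ℤ
  F₃≡0 = solve-∀

  D₃-syzygy : ∀ α β δ ρ σ lm →
    let D₂ = (α - σ) * 0ℤ + δ * ρ + σ - (β - 0ℤ) * δ - 0ℤ * 0ℤ
        F₁ = (β - 0ℤ) * (β - 0ℤ) + 0ℤ * (lm - lm) - (lm - lm) * (α - σ) - ρ * (β - 0ℤ) - lm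
    in (α - σ) * 0ℤ + δ * lm - (β - 0ℤ) * σ - 0ℤ * 0ℤ ≡ F₁ * (- δ) - D₂ * β
  D₃-syzygy = solve-∀

  equations⇒condition : ∀ {α β δ ρ σ θ lm} →
    AssociativityEquations α β lm δ 0ℤ ρ σ θ lm → CondB α β lm δ 0ℤ ρ σ θ lm
  equations⇒condition {α} {β} {δ} {ρ} {σ} {θ} {lm} eqs
    with neg-injective {θ} {0ℤ} (trans (sym (D₁≡-θ β δ θ lm)) (AssociativityEquations.D₁≡0 eqs))
  ... | refl = refl , refl , refl , λ-eq , λ-eq , σ-eq
    where
    open AssociativityEquations eqs
    λ-eq : lm ≡ - (β * (ρ - β))
    λ-eq = sym (i-j≡0⇒i≡j _ _ (trans (sym (F₁≡λ-residual α β ρ σ lm)) F₁≡0))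
    σ-eq : σ ≡ - (δ * (ρ - β))
    σ-eq = i-j≡0⇒i≡j _ _ (trans (sym (D₂≡σ-residual α β δ ρ σ)) D₂≡0)

  condition⇒equations : ∀ {α β δ ρ σ lm} →
    CondB α β lm δ 0ℤ ρ σ 0ℤ lm → AssociativityEquations α β lm δ 0ℤ ρ σ 0ℤ lm
  condition⇒equations {α} {β} {δ} {ρ} {σ} {lm} (_ , _ , _ , _ , λ-eq , σ-eq) = record
    { D₁≡0 = D₁≡-θ β δ 0ℤ lm
    ; D₂≡0 = D₂≡0
    ; D₃≡0 = trans (D₃-syzygy α β δ ρ σ lm) (cong₂ _-_ (cong (_* (- δ)) F₁≡0) (cong (_* β) D₂≡0))
    ; F₁≡0 = F₁≡0
    ; F₃≡0 = F₃≡0 β ρ σ lm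
    }
    where
    open AssociatorCoordinates α β lm δ 0ℤ ρ σ 0ℤ lm
    D₂≡0 : D₂ ≡ 0ℤ
    D₂≡0 = trans (D₂≡σ-residual α β δ ρ σ) (i≡j⇒i-j≡0 σ-eq)
    F₁≡0 : F₁ ≡ 0ℤ
    F₁≡0 = trans (F₁≡λ-residual α β ρ σ lm) (i≡j⇒i-j≡0 (sym λ-eq))

equations⇒conditions : ∀ {α β φ δ γ ρ σ θ lm} →
  AssociativityEquations α β φ δ γ ρ σ θ lm → Conditions α β φ δ γ ρ σ θ lm
equations⇒conditions {φ = φ} {γ = γ} {lm = lm} eqs with φ ≟ lm | γ ≟ 0ℤ
... | no φ≢lm  | _        = inj₂ (inj₂ (CaseC.equations⇒condition φ≢lm eqs))
... | yes refl | no γ≢0   = inj₁ (CaseA.equations⇒condition γ≢0 eqs)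
... | yes refl | yes refl = inj₂ (inj₁ (CaseB.equations⇒condition eqs))

conditions⇒equations : ∀ {α β φ δ γ ρ σ θ lm} →
  Conditions α β φ δ γ ρ σ θ lm → AssociativityEquations α β φ δ γ ρ σ θ lm
conditions⇒equations (inj₁ c@(refl , _))                  = CaseA.condition⇒equations c
conditions⇒equations (inj₂ (inj₁ c@(refl , refl , refl , _))) = CaseB.condition⇒equations c
conditions⇒equations (inj₂ (inj₂ c))                      = CaseC.condition⇒equations c

-- The explicit form

-- p x y z u v w (pᵢ in the associator identities) is the i-th coordinate of
-- formMat … x y z ·v (u, v, w), i.e. of (x, y, z) • (u, v, w).
product-comm₀ : ∀ α β φ x y z u v w →
  let p x y z u v w = (α * (x - z) + β * y + z) * u + ((β * (x - z) + φ * y) * v + (((1ℤ - α) * (x - z) - β * y) * w + 0ℤ))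
  in p x y z u v w ≡ p u v w x y z
product-comm₀ = solve-∀

product-comm₁ : ∀ δ γ ρ x y z u v w →
  let p x y z u v w = (δ * (x - z) + γ * y) * u + ((γ * (x - z) + ρ * y + z) * v + ((- δ * (x - z) + (1ℤ - γ) * y) * w + 0ℤ))
  in p x y z u v w ≡ p u v w x y z
product-comm₁ = solve-∀

product-comm₂ : ∀ σ θ lm x y z u v w →
  let p x y z u v w = (σ * (x - z) + θ * y) * u + ((θ * (x - z) + lm * y) * v + ((- σ * (x - z) - θ * y + z) * w + 0ℤ))
  in p x y z u v w ≡ p u v w x y z
product-comm₂ = solve-∀

associator₀ : ∀ α β φ δ γ ρ σ θ lm x y z u v w r s t →
  let p₀ x y z u v w = (α * (x - z) + β * y + z) * u + ((β * (x - z) + φ * y) * v + (((1ℤ - α) * (x - z) - β * y) * w + 0ℤ))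
      p₁ x y z u v w = (δ * (x - z) + γ * y) * u + ((γ * (x - z) + ρ * y + z) * v + ((- δ * (x - z) + (1ℤ - γ) * y) * w + 0ℤ))
      p₂ x y z u v w = (σ * (x - z) + θ * y) * u + ((θ * (x - z) + lm * y) * v + ((- σ * (x - z) - θ * y + z) * w + 0ℤ))
      D₁ = δ * (φ - lm) - (β - θ) * γ - θ
      D₂ = (α - σ) * γ + δ * ρ + σ - (β - θ) * δ - γ * γ
      D₃ = (α - σ) * θ + δ * lm - (β - θ) * σ - γ * θ
      F₁ = (β - θ) * (β - θ) + γ * (φ - lm) - (φ - lm) * (α - σ) - ρ * (β - θ) - lm
      F₃ = (β - θ) * θ + γ * lm - (φ - lm) * σ - ρ * θ
  in p₀ (p₀ x y z u v w) (p₁ x y z u v w) (p₂ x y z u v w) r s t - p₀ x y z (p₀ u v w r s t) (p₁ u v w r s t) (p₂ u v w r s t)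
     ≡ ((D₁ + D₃) * (u - w) + (F₁ + F₃) * v) * ((x - z) * s - y * (r - t))
associator₀ = solve-∀

associator₁ : ∀ α β φ δ γ ρ σ θ lm x y z u v w r s t →
  let p₀ x y z u v w = (α * (x - z) + β * y + z) * u + ((β * (x - z) + φ * y) * v + (((1ℤ - α) * (x - z) - β * y) * w + 0ℤ))
      p₁ x y z u v w = (δ * (x - z) + γ * y) * u + ((γ * (x - z) + ρ * y + z) * v + ((- δ * (x - z) + (1ℤ - γ) * y) * w + 0ℤ))
      p₂ x y z u v w = (σ * (x - z) + θ * y) * u + ((θ * (x - z) + lm * y) * v + ((- σ * (x - z) - θ * y + z) * w + 0ℤ))
      D₁ = δ * (φ - lm) - (β - θ) * γ - θ
      D₂ = (α - σ) * γ + δ * ρ + σ - (β - θ) * δ - γ * γ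
      D₃ = (α - σ) * θ + δ * lm - (β - θ) * σ - γ * θ
      F₁ = (β - θ) * (β - θ) + γ * (φ - lm) - (φ - lm) * (α - σ) - ρ * (β - θ) - lm
      F₃ = (β - θ) * θ + γ * lm - (φ - lm) * σ - ρ * θ
  in p₁ (p₀ x y z u v w) (p₁ x y z u v w) (p₂ x y z u v w) r s t - p₁ x y z (p₀ u v w r s t) (p₁ u v w r s t) (p₂ u v w r s t)
     ≡ (D₂ * (u - w) + (- D₁) * v) * ((x - z) * s - y * (r - t))
associator₁ = solve-∀

associator₂ : ∀ α β φ δ γ ρ σ θ lm x y z u v w r s t →
  let p₀ x y z u v w = (α * (x - z) + β * y + z) * u + ((β * (x - z) + φ * y) * v + (((1ℤ - α) * (x - z) - β * y) * w + 0ℤ))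
      p₁ x y z u v w = (δ * (x - z) + γ * y) * u + ((γ * (x - z) + ρ * y + z) * v + ((- δ * (x - z) + (1ℤ - γ) * y) * w + 0ℤ))
      p₂ x y z u v w = (σ * (x - z) + θ * y) * u + ((θ * (x - z) + lm * y) * v + ((- σ * (x - z) - θ * y + z) * w + 0ℤ))
      D₁ = δ * (φ - lm) - (β - θ) * γ - θ
      D₂ = (α - σ) * γ + δ * ρ + σ - (β - θ) * δ - γ * γ
      D₃ = (α - σ) * θ + δ * lm - (β - θ) * σ - γ * θ
      F₁ = (β - θ) * (β - θ) + γ * (φ - lm) - (φ - lm) * (α - σ) - ρ * (β - θ) - lm
      F₃ = (β - θ) * θ + γ * lm - (φ - lm) * σ - ρ * θ
  in p₂ (p₀ x y z u v w) (p₁ x y z u v w) (p₂ x y z u v w) r s t - p₂ x y z (p₀ u v w r s t) (p₁ u v w r s t) (p₂ u v w r s t)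
     ≡ (D₃ * (u - w) + F₃ * v) * ((x - z) * s - y * (r - t))
associator₂ = solve-∀

vanishing-combination : ∀ {p q} c d k → p ≡ 0ℤ → q ≡ 0ℤ → (p * c + q * d) * k ≡ 0ℤ
vanishing-combination _ _ _ refl refl = refl

first-coefficient≡0 : ∀ p q {d} → d ≡ (p * 1ℤ + q * 0ℤ) * 1ℤ → d ≡ 0ℤ → p ≡ 0ℤ
first-coefficient≡0 p q d≡ d≡0 = trans (sym (simplify p q)) (trans (sym d≡) d≡0)
  where
  simplify : ∀ p q → (p * 1ℤ + q * 0ℤ) * 1ℤ ≡ p
  simplify = solve-∀

second-coefficient≡0 : ∀ p q {d} → d ≡ (p * 0ℤ + q * 1ℤ) * 1ℤ → d ≡ 0ℤ → q ≡ 0ℤ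
second-coefficient≡0 p q d≡ d≡0 = trans (sym (simplify p q)) (trans (sym d≡) d≡0)
  where
  simplify : ∀ p q → (p * 0ℤ + q * 1ℤ) * 1ℤ ≡ q
  simplify = solve-∀

module ExplicitForm (α β φ δ γ ρ σ θ lm : ℤ) where
  open AssociatorCoordinates α β φ δ γ ρ σ θ lm

  ν : Z3 → M3
  ν (x ∷ y ∷ z ∷ []) = formMat α β φ δ γ ρ σ θ lm x y z

  commutative : Commutative ν
  commutative = vec3-elim₂ λ x y z u v w → vec3-ext
    (product-comm₀ α β φ x y z u v w) (product-comm₁ δ γ ρ x y z u v w) (product-comm₂ σ θ lm x y z u v w)

  unital : Unital ν
  unital = vec3-ext
    (vec3-ext (cong (_+ 1ℤ) (vanish₊ α β)) (vanish₊ β φ) (vanish₋ (1ℤ - α) β))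
    (vec3-ext (vanish₊ δ γ) (cong (_+ 1ℤ) (vanish₊ γ ρ)) (vanish₊ (- δ) (1ℤ - γ)))
    (vec3-ext (vanish₊ σ θ) (vanish₊ θ lm) (cong (_+ 1ℤ) (vanish₋ (- σ) θ)))
    where
    vanish₊ : ∀ a b → a * 0ℤ + b * 0ℤ ≡ 0ℤ
    vanish₊ a b = cong₂ _+_ (*-zeroʳ a) (*-zeroʳ b)
    vanish₋ : ∀ a b → a * 0ℤ - b * 0ℤ ≡ 0ℤ
    vanish₋ a b = cong₂ _-_ (*-zeroʳ a) (*-zeroʳ b)

  associator : ∀ x y z u v w r s t →
    let a = x ∷ y ∷ z ∷ []
        b = u ∷ v ∷ w ∷ []
        c = r ∷ s ∷ t ∷ []
        k = (x - z) * s - y * (r - t)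
    in lookup (ν (ν a ·v b) ·v c) zero - lookup (ν a ·v (ν b ·v c)) zero
         ≡ ((D₁ + D₃) * (u - w) + (F₁ + F₃) * v) * k
     × lookup (ν (ν a ·v b) ·v c) (suc zero) - lookup (ν a ·v (ν b ·v c)) (suc zero)
         ≡ (D₂ * (u - w) + (- D₁) * v) * k
     × lookup (ν (ν a ·v b) ·v c) (suc (suc zero)) - lookup (ν a ·v (ν b ·v c)) (suc (suc zero))
         ≡ (D₃ * (u - w) + F₃ * v) * k
  associator x y z u v w r s t =
      associator₀ α β φ δ γ ρ σ θ lm x y z u v w r s t
    , associator₁ α β φ δ γ ρ σ θ lm x y z u v w r s t
    , associator₂ α β φ δ γ ρ σ θ lm x y z u v w r s t

  equations⇒associative : AssociativityEquations α β φ δ γ ρ σ θ lm → Associative ν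
  equations⇒associative eqs = vec3-elim₃ λ x y z u v w r s t →
    let a₀ , a₁ , a₂ = associator x y z u v w r s t in vec3-ext
      (i-j≡0⇒i≡j _ _ (trans a₀ (vanishing-combination _ _ _ (cong₂ _+_ D₁≡0 D₃≡0) (cong₂ _+_ F₁≡0 F₃≡0))))
      (i-j≡0⇒i≡j _ _ (trans a₁ (vanishing-combination _ _ _ D₂≡0 (cong -_ D₁≡0))))
      (i-j≡0⇒i≡j _ _ (trans a₂ (vanishing-combination _ _ _ D₃≡0 F₃≡0)))
    where open AssociativityEquations eqs

  associative⇒equations : Associative ν → AssociativityEquations α β φ δ γ ρ σ θ lm
  associative⇒equations assoc = record
    { D₁≡0 = trans (sym (+-identityʳ D₁)) (trans (cong (D₁ +_) (sym D₃≡0)) D₁+D₃≡0)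
    ; D₂≡0 = D₂≡0
    ; D₃≡0 = D₃≡0
    ; F₁≡0 = trans (sym (+-identityʳ F₁)) (trans (cong (F₁ +_) (sym F₃≡0)) F₁+F₃≡0)
    ; F₃≡0 = F₃≡0
    }
    where
    associator≡0 : ∀ a b c i → lookup (ν (ν a ·v b) ·v c) i - lookup (ν a ·v (ν b ·v c)) i ≡ 0ℤ
    associator≡0 a b c i = i≡j⇒i-j≡0 (cong (λ v → lookup v i) (assoc a b c))
    D₁+D₃≡0 : D₁ + D₃ ≡ 0ℤ
    D₁+D₃≡0 = first-coefficient≡0 (D₁ + D₃) (F₁ + F₃)
      (proj₁ (associator 1ℤ 0ℤ 0ℤ 1ℤ 0ℤ 0ℤ 0ℤ 1ℤ 0ℤ)) (associator≡0 e₁ e₁ e₂ zero)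
    D₂≡0 : D₂ ≡ 0ℤ
    D₂≡0 = first-coefficient≡0 D₂ (- D₁)
      (proj₁ (proj₂ (associator 1ℤ 0ℤ 0ℤ 1ℤ 0ℤ 0ℤ 0ℤ 1ℤ 0ℤ))) (associator≡0 e₁ e₁ e₂ (suc zero))
    D₃≡0 : D₃ ≡ 0ℤ
    D₃≡0 = first-coefficient≡0 D₃ F₃
      (proj₂ (proj₂ (associator 1ℤ 0ℤ 0ℤ 1ℤ 0ℤ 0ℤ 0ℤ 1ℤ 0ℤ))) (associator≡0 e₁ e₁ e₂ (suc (suc zero)))
    F₁+F₃≡0 : F₁ + F₃ ≡ 0ℤ
    F₁+F₃≡0 = second-coefficient≡0 (D₁ + D₃) (F₁ + F₃)
      (proj₁ (associator 1ℤ 0ℤ 0ℤ 0ℤ 1ℤ 0ℤ 0ℤ 1ℤ 0ℤ)) (associator≡0 e₁ e₂ e₂ zero)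
    F₃≡0 : F₃ ≡ 0ℤ
    F₃≡0 = second-coefficient≡0 D₃ F₃
      (proj₂ (proj₂ (associator 1ℤ 0ℤ 0ℤ 0ℤ 1ℤ 0ℤ 0ℤ 1ℤ 0ℤ))) (associator≡0 e₁ e₂ e₂ (suc (suc zero)))

  natural⇒conditions : NaturalInjection ν → Conditions α β φ δ γ ρ σ θ lm
  natural⇒conditions (_ , mult , _ , _) =
    equations⇒conditions (associative⇒equations (multiplicative⇒associative mult))

  conditions⇒natural : Conditions α β φ δ γ ρ σ θ lm → NaturalInjection ν
  conditions⇒natural conditions =
      commutative-unital⇒injective commutative unital
    , associative⇒multiplicative (equations⇒associative (conditions⇒equations conditions))
    , commutative
    , unital

mainTheorem1 : (ν : Z3 → M3) →
    (NaturalInjection ν → HasExplicitForm ν) × (HasExplicitForm ν → NaturalInjection ν)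
mainTheorem1 ν = forward , backward
  where
  forward : NaturalInjection ν → HasExplicitForm ν
  forward natural@(_ , _ , comm , unit) =
    α , β , φ , δ , γ , ρ , σ , θ , lm , explicit-form , natural⇒conditions (natural-resp ν≗explicit natural)
    where
    open CommutativeUnital comm unit
    open ExplicitForm α β φ δ γ ρ σ θ lm using (natural⇒conditions) renaming (ν to explicit)
    ν≗explicit : ∀ a → ν a ≡ explicit a
    ν≗explicit = vec3-elim {P = λ a → ν a ≡ explicit a} explicit-form

  backward : HasExplicitForm ν → NaturalInjection ν
  backward (α , β , φ , δ , γ , ρ , σ , θ , lm , explicit-form , conditions) =
    natural-resp explicit≗ν (conditions⇒natural conditions)
    where
    open ExplicitForm α β φ δ γ ρ σ θ lm using (conditions⇒natural) renaming (ν to explicit)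
    explicit≗ν : ∀ a → explicit a ≡ ν a
    explicit≗ν = vec3-elim {P = λ a → explicit a ≡ ν a} (λ x y z → sym (explicit-form x y z))
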